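{- Let $n\ge2$ be a power of $2$. For any $i \in [\log_2 n]$, the sequence $f_i$ contains a collection $\mathcal{C}$ of $n/2$ disjoint $(1,2)$-copies.
   Context: Identify the domain with $\{0,1,\dots,n-1\}$. Every $t$ in it has a unique binary representation $(b^t_1,\dots,b^t_{\log_2 n})\in\{0,1\}^{\log_2 n}$ with $t=\sum_{j} b^t_j 2^{j-1}$. For $i\in[\log_2 n]$, $F_i$ flips the $i$-th bit of the representation. Let $f^{\downarrow}(x)=n+1-x$ and $f_i=f^{\downarrow}\circ F_i$. A $(1,2)$-copy in $f_i$ is a pair $x<y$ with $f_i(x)<f_i(y)$; copies are disjoint if they share no element. -}

module Defs where

open import Data.Nat using (ℕ; zero; suc; _+_; _∸_; _^_; _<_; _≟_)
open import Data.Nat.DivMod using (_/_; _%_)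
open import Data.Bool using (if_then_else_)
open import Data.Product using (_×_; _,_; proj₁; proj₂)
open import Data.List using (List; []; _∷_; _++_; concatMap)
open import Data.List.Relation.Unary.All using (All)
open import Data.List.Relation.Unary.Unique.Propositional using (Unique)
open import Relation.Nullary using (does)
open import Data.Nat.Properties using (m^n≢0)

-- j-th binary digit b^t_j of t (j ≥ 1), so that t = Σ_j b^t_j 2^(j-1)
bit : ℕ → ℕ → ℕ
bit j t = _/_ t (2 ^ (j ∸ 1)) {{m^n≢0 2 (j ∸ 1)}} % 2

F : ℕ → ℕ → ℕ
F i t = if does (bit i t ≟ 0) then t + 2 ^ (i ∸ 1) else t ∸ 2 ^ (i ∸ 1)

fdown : ℕ → ℕ → ℕ
fdown n x = (n + 1) ∸ x

f : ℕ → ℕ → ℕ → ℕ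
f n i x = fdown n (F i x)

Copy12 : ℕ → ℕ → ℕ × ℕ → Set
Copy12 n i (x , y) = x < n × y < n × x < y × f n i x < f n i y

elems : List (ℕ × ℕ) → List ℕ
elems = concatMap (λ p → proj₁ p ∷ proj₂ p ∷ [])

DisjointCopies : ℕ → ℕ → List (ℕ × ℕ) → Set
DisjointCopies n i C = All (Copy12 n i) C × Unique (elems C)

module Submission where

-- Let p = 2^(i-1).  Every t < n is either "low" (its i-th binary
-- digit is 0) or "high" (digit 1), and F_i maps the low number x to x + p and
-- back.  Since f↓ reverses the order, each pair (x , x + p) with x low is a
-- (1,2)-copy of f_i = f↓ ∘ F_i, and these n/2 pairs partition the domain.
--
-- The pairs are enumerated by s < n/2 through "digit insertion": writing
-- s = b·p + r with r < p, the number insert e s = (2b + e)·p + r has the same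
-- digits as s with the digit e inserted at position i.

open import Defs
open import Data.Nat using (ℕ; _^_; _≤_; _/_)
open import Data.Product using (Σ; _×_; _,_)
open import Data.List using (List; length)
open import Relation.Binary.PropositionalEquality using (_≡_)

open import Data.Nat using (suc; _+_; _*_; _∸_; _<_; _%_; NonZero; z≤n; s≤s)
open import Data.Nat.Properties
open import Data.Nat.DivMod
open import Data.Nat.Divisibility using (n∣m*n)
open import Data.Nat.Tactic.RingSolver using (solve-∀)
open import Data.Product using (proj₁; proj₂)
open import Data.List using ([]; _∷_; map; upTo)
open import Data.List.Properties using (length-map; length-upTo)
open import Data.List.Relation.Unary.All as All using (All; []; _∷_)
import Data.List.Relation.Unary.All.Properties as AllP
open import Data.List.Relation.Unary.AllPairs using ([]; _∷_)
open import Data.List.Relation.Unary.Unique.Propositional using (Unique)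
open import Data.List.Relation.Unary.Unique.Propositional.Properties using (upTo⁺)
open import Function using (_∘_)
open import Relation.Binary.PropositionalEquality
  using (_≢_; refl; sym; trans; cong; cong₂; subst; subst₂; module ≡-Reasoning)

module MixedRadix {d : ℕ} .{{_ : NonZero d}} where

  quotient : ∀ a {r} → r < d → (a * d + r) / d ≡ a
  quotient a {r} r<d = begin
      (a * d + r) / d   ≡⟨ +-distrib-/-∣ˡ r (n∣m*n a) ⟩
      a * d / d + r / d ≡⟨ cong₂ _+_ (m*n/n≡m a d) (m<n⇒m/n≡0 r<d) ⟩
      a + 0             ≡⟨ +-identityʳ a ⟩
      a                 ∎
    where open ≡-Reasoning

  remainder : ∀ a {r} → r < d → (a * d + r) % d ≡ r
  remainder a {r} r<d = trans (%-remove-+ˡ r (n∣m*n a)) (m<n⇒m%n≡m r<d)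

  injective : ∀ {a a′ r r′} → r < d → r′ < d →
              a * d + r ≡ a′ * d + r′ → a ≡ a′ × r ≡ r′
  injective {a} {a′} r<d r′<d eq =
      trans (sym (quotient a r<d)) (trans (cong (_/ d) eq) (quotient a′ r′<d))
    , trans (sym (remainder a r<d)) (trans (cong (_% d) eq) (remainder a′ r′<d))

  bounded : ∀ {a m r} → a < m → r < d → a * d + r < m * d
  bounded {a} {m} {r} a<m r<d = begin-strict
      a * d + r <⟨ +-monoʳ-< (a * d) r<d ⟩
      a * d + d ≡⟨ +-comm (a * d) d ⟩
      suc a * d ≤⟨ *-monoˡ-≤ d a<m ⟩
      m * d     ∎
    where open ≤-Reasoning

module DigitInsertion (p : ℕ) .{{_ : NonZero p}} where

  insert : ℕ → ℕ → ℕ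
  insert e s = (s / p * 2 + e) * p + s % p

  insert-digit : ∀ {e} s → e < 2 → insert e s / p % 2 ≡ e
  insert-digit {e} s e<2 = begin
      insert e s / p % 2    ≡⟨ cong (_% 2) (MixedRadix.quotient (s / p * 2 + e) (m%n<n s p)) ⟩
      (s / p * 2 + e) % 2   ≡⟨ MixedRadix.remainder (s / p) e<2 ⟩
      e                     ∎
    where open ≡-Reasoning

  insert-one : ∀ s → insert 1 s ≡ insert 0 s + p
  insert-one s = shift (s / p * 2) p (s % p)
    where
    shift : ∀ a p r → (a + 1) * p + r ≡ (a + 0) * p + r + p
    shift = solve-∀

  insert-injective : ∀ {e e′ s s′} → e < 2 → e′ < 2 →
                     insert e s ≡ insert e′ s′ → e ≡ e′ × s ≡ s′
  insert-injective {e} {e′} {s} {s′} e<2 e′<2 eq = proj₂ digits , same-s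
    where
    open ≡-Reasoning
    split : s / p * 2 + e ≡ s′ / p * 2 + e′ × s % p ≡ s′ % p
    split = MixedRadix.injective (m%n<n s p) (m%n<n s′ p) eq
    digits : s / p ≡ s′ / p × e ≡ e′
    digits = MixedRadix.injective e<2 e′<2 (proj₁ split)
    same-s : s ≡ s′
    same-s = begin
      s                   ≡⟨ m≡m%n+[m/n]*n s p ⟩
      s % p + s / p * p   ≡⟨ cong₂ (λ r b → r + b * p) (proj₂ split) (proj₁ digits) ⟩
      s′ % p + s′ / p * p ≡⟨ sym (m≡m%n+[m/n]*n s′ p) ⟩
      s′                  ∎

  insert-< : ∀ {e s} q → e < 2 → s < q * p → insert e s < 2 * q * p
  insert-< {e} {s} q e<2 s<qp =
    subst (insert e s <_) (cong (_* p) (*-comm q 2))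
      (MixedRadix.bounded (MixedRadix.bounded {m = q} (m<n*o⇒m/o<n s<qp) e<2) (m%n<n s p))

F-clear : ∀ i t → bit i t ≡ 0 → F i t ≡ t + 2 ^ (i ∸ 1)
F-clear i t digit rewrite digit = refl

F-set : ∀ i t → bit i t ≡ 1 → F i t ≡ t ∸ 2 ^ (i ∸ 1)
F-set i t digit rewrite digit = refl

fdown-reverses : ∀ {n x y} → x < y → y < n → fdown n y < fdown n x
fdown-reverses {n} x<y y<n = ∸-monoʳ-< x<y (≤-trans (<⇒≤ y<n) (m≤m+n n 1))

swapped-pair-is-copy : ∀ {n i x y} → x < y → y < n →
                       F i x ≡ y → F i y ≡ x → Copy12 n i (x , y)
swapped-pair-is-copy {n} x<y y<n Fx≡y Fy≡x =
    <-trans x<y y<n , y<n , x<y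
  , subst₂ (λ a b → fdown n a < fdown n b) (sym Fx≡y) (sym Fy≡x) (fdown-reverses x<y y<n)

module PairLists (u v : ℕ → ℕ) where

  pair : ℕ → ℕ × ℕ
  pair s = u s , v s

  All-elems : ∀ {P : ℕ → Set} {xs} → All (λ t → P (u t) × P (v t)) xs →
              All P (elems (map pair xs))
  All-elems []               = []
  All-elems ((Pu , Pv) ∷ ps) = Pu ∷ Pv ∷ All-elems ps

  elems-unique : (∀ {s t} → u s ≡ u t → s ≡ t) → (∀ {s t} → v s ≡ v t → s ≡ t) →
                 (∀ s t → u s ≢ v t) → ∀ {xs} → Unique xs → Unique (elems (map pair xs))
  elems-unique u-inj v-inj disjoint [] = []
  elems-unique u-inj v-inj disjoint {s ∷ _} (s∉ts ∷ ts-unique) =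
      (disjoint s s ∷ All-elems (All.map (λ s≢t → s≢t ∘ u-inj , disjoint s _) s∉ts))
    ∷ All-elems (All.map (λ s≢t → (λ eq → disjoint _ s (sym eq)) , s≢t ∘ v-inj) s∉ts)
    ∷ elems-unique u-inj v-inj disjoint ts-unique

module CopyCollection (i : ℕ) where

  p : ℕ
  p = 2 ^ (i ∸ 1)

  instance
    p≢0 : NonZero p
    p≢0 = m^n≢0 2 (i ∸ 1)

  open DigitInsertion p

  low high : ℕ → ℕ
  low  = insert 0
  high = insert 1

  open PairLists low high

  0<2 : 0 < 2
  0<2 = s≤s z≤n

  1<2 : 1 < 2
  1<2 = s≤s (s≤s z≤n)

  F-low : ∀ s → F i (low s) ≡ high s
  F-low s = trans (F-clear i (low s) (insert-digit s 0<2)) (sym (insert-one s))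

  F-high : ∀ s → F i (high s) ≡ low s
  F-high s = begin
      F i (high s)    ≡⟨ F-set i (high s) (insert-digit s 1<2) ⟩
      high s ∸ p      ≡⟨ cong (_∸ p) (insert-one s) ⟩
      low s + p ∸ p   ≡⟨ m+n∸n≡m (low s) p ⟩
      low s           ∎
    where open ≡-Reasoning

  pair-is-copy : ∀ q {s} → s < q * p → Copy12 (2 * q * p) i (pair s)
  pair-is-copy q {s} s<qp =
    swapped-pair-is-copy {i = i} low<high (insert-< q 1<2 s<qp) (F-low s) (F-high s)
    where
    low<high : low s < high s
    low<high = subst (low s <_) (sym (insert-one s)) (m<m+n (low s) (m^n>0 2 (i ∸ 1)))

  copies : ℕ → List (ℕ × ℕ)
  copies q = map pair (upTo (q * p))

  copies-disjoint : ∀ q → DisjointCopies (2 * q * p) i (copies q)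
  copies-disjoint q =
      AllP.map⁺ (All.map (pair-is-copy q) (AllP.all-upTo (q * p)))
    , elems-unique (proj₂ ∘ insert-injective 0<2 0<2)
                   (proj₂ ∘ insert-injective 1<2 1<2)
                   (λ s t eq → 0≢1 (proj₁ (insert-injective 0<2 1<2 eq)))
                   (upTo⁺ (q * p))
    where
    0≢1 : 0 ≢ 1
    0≢1 ()

  copies-length : ∀ q → length (copies q) ≡ q * p
  copies-length q = trans (length-map pair (upTo (q * p))) (length-upTo (q * p))

power-split : ∀ {i k} → 1 ≤ i → i ≤ k → 2 ^ k ≡ 2 * 2 ^ (k ∸ i) * 2 ^ (i ∸ 1)
power-split {suc i′} {k} (s≤s z≤n) i≤k = begin
    2 ^ k                         ≡⟨ cong (2 ^_) (sym (m+[n∸m]≡n i≤k)) ⟩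
    2 ^ (suc i′ + (k ∸ suc i′))   ≡⟨ cong (λ m → 2 ^ suc m) (+-comm i′ (k ∸ suc i′)) ⟩
    2 ^ (suc (k ∸ suc i′) + i′)   ≡⟨ ^-distribˡ-+-* 2 (suc (k ∸ suc i′)) i′ ⟩
    2 * 2 ^ (k ∸ suc i′) * 2 ^ i′ ∎
  where open ≡-Reasoning

half : ∀ q p → 2 * q * p / 2 ≡ q * p
half q p = trans (/-congˡ (trans (*-assoc 2 q p) (*-comm 2 (q * p)))) (m*n/n≡m (q * p) 2)

lemma4p4 : (k n i : ℕ) → 1 ≤ k → n ≡ 2 ^ k → 1 ≤ i → i ≤ k →
    Σ (List (ℕ × ℕ)) (λ C → DisjointCopies n i C × length C ≡ n / 2)
lemma4p4 k n i _ n≡2^k 1≤i i≤k =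
  subst (λ m → Σ (List (ℕ × ℕ)) (λ C → DisjointCopies m i C × length C ≡ m / 2))
        (sym (trans n≡2^k (power-split 1≤i i≤k)))
        ( copies q
        , copies-disjoint q
        , trans (copies-length q) (sym (half q p)))
  where
  open CopyCollection i
  q : ℕ
  q = 2 ^ (k ∸ i)
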